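{- Let $\Pi$ be a decidable equivalence relation on $\mathbb{N}$ and let $f, g$ be recursive permutations of $\mathbb{N}$ whose cycles are both exactly the blocks of $\Pi$. Then $f$ and $g$ are effectively conjugate, i.e. there is a recursive permutation $h$ with $f = h^{ -1} g h$. Moreover, a program for such an $h$ can be computed from programs for $f$, $g$ and a decider $\pi$ for $\Pi$.
   Context: The cycle of $x$ under a permutation $f$ is $\{f^k(x):k\in\mathbb{Z}\}$. An equivalence relation is decidable if there is a total recursive function deciding, for all $x,x'$, whether $x$ and $x'$ are equivalent. -}

module Defs where

open import Data.Nat using (ℕ; zero; suc)
open import Data.Integer using (ℤ; +_; -[1+_])
open import Data.Product using (∃)
open import Function.Bundles using (_↔_; Inverse)
open import Relation.Binary.PropositionalEquality using (_≡_)

-- A recursive permutation of ℕ: a (computable, as every Agda function is)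
-- bijection ℕ → ℕ packaged with its inverse.
RecPerm : Set
RecPerm = ℕ ↔ ℕ

iterate : (ℕ → ℕ) → ℕ → ℕ → ℕ
iterate h zero    x = x
iterate h (suc n) x = h (iterate h n x)

pow : RecPerm → ℤ → ℕ → ℕ
pow f (+ n)      = iterate (Inverse.to f) n
pow f -[1+ n ]   = iterate (Inverse.from f) (suc n)

InCycle : RecPerm → ℕ → ℕ → Set
InCycle f x y = ∃ λ (k : ℤ) → pow f k x ≡ y

-- Send x = f^k(r), where r is the least element of the block of x, to g^k(r).
-- This is well defined because f^a(r) = f^b(r) forces g^a(r) = g^b(r).  If r is periodic under f,
-- its g-orbit lies in its finite f-orbit, so by pigeonhole r is g-periodic with least period at
-- most that under f; by symmetry the least periods agree, and the return times of r are exactly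
-- the multiples of that period.  The map intertwines f and g, and exchanging the roles of f and g
-- yields its inverse.  Every step is a total Agda function, so the conjugator is computed from
-- f, g and the decider for Π.

module Submission where

open import Defs
open import Data.Nat using (ℕ; zero; suc; _+_; _*_; _<_; _≤_; s≤s⁻¹; NonZero; _≟_)
open import Data.Nat.Properties
open import Data.Nat.DivMod using (_%_; _/_; m≡m%n+[m/n]*n; m%n<n)
open import Data.Integer as ℤ using (ℤ; +_; -[1+_])
open import Data.Product using (Σ; ∃; ∃₂; _,_; _×_; proj₁; proj₂)
open import Data.Sum using (inj₁; inj₂)
open import Data.Fin using (Fin; toℕ; fromℕ<)
open import Data.Fin.Properties using (pigeonhole; toℕ<n; toℕ-fromℕ<)
open import Function.Base using (_∘_)
open import Function.Bundles using (_⇔_; Inverse; Equivalence; mk↔ₛ′)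
open import Function.Properties.Equivalence using () renaming (sym to ⇔-sym; trans to ⇔-trans)
open import Relation.Binary.Core using (Rel)
open import Relation.Binary.Structures using (IsDecEquivalence)
open import Relation.Binary.PropositionalEquality using (_≡_; refl; sym; trans; cong; subst; module ≡-Reasoning)
open import Relation.Nullary using (¬_; Dec; yes; no; contradiction)
open import Level using (0ℓ)
open ≡-Reasoning

module _ (h : ℕ → ℕ) where

  iterate-suc : ∀ n x → iterate h (suc n) x ≡ iterate h n (h x)
  iterate-suc zero    x = refl
  iterate-suc (suc n) x = cong h (iterate-suc n x)

  iterate-+ : ∀ m n x → iterate h (m + n) x ≡ iterate h m (iterate h n x)
  iterate-+ zero    n x = refl
  iterate-+ (suc m) n x = cong h (iterate-+ m n x)

  iterate-comm : ∀ m n x → iterate h m (iterate h n x) ≡ iterate h n (iterate h m x)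
  iterate-comm m n x = begin
    iterate h m (iterate h n x) ≡⟨ iterate-+ m n x ⟨
    iterate h (m + n) x         ≡⟨ cong (λ k → iterate h k x) (+-comm m n) ⟩
    iterate h (n + m) x         ≡⟨ iterate-+ n m x ⟩
    iterate h n (iterate h m x) ∎

  iterate-* : ∀ {d x} → iterate h d x ≡ x → ∀ q → iterate h (q * d) x ≡ x
  iterate-* {d} {x} hᵈx≡x zero    = refl
  iterate-* {d} {x} hᵈx≡x (suc q) = begin
    iterate h (d + q * d) x           ≡⟨ iterate-+ d (q * d) x ⟩
    iterate h d (iterate h (q * d) x) ≡⟨ cong (iterate h d) (iterate-* hᵈx≡x q) ⟩
    iterate h d x                     ≡⟨ hᵈx≡x ⟩
    x                                 ∎

  iterate-% : ∀ {d x} .{{_ : NonZero d}} → iterate h d x ≡ x →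
              ∀ n → iterate h n x ≡ iterate h (n % d) x
  iterate-% {d} {x} hᵈx≡x n = begin
    iterate h n x                                   ≡⟨ cong (λ k → iterate h k x) (m≡m%n+[m/n]*n n d) ⟩
    iterate h (n % d + (n / d) * d) x               ≡⟨ iterate-+ (n % d) ((n / d) * d) x ⟩
    iterate h (n % d) (iterate h ((n / d) * d) x)   ≡⟨ cong (iterate h (n % d)) (iterate-* hᵈx≡x (n / d)) ⟩
    iterate h (n % d) x                             ∎

module _ {h h⁻ : ℕ → ℕ} (h⁻∘h≗id : ∀ x → h⁻ (h x) ≡ x) where

  iterate-inverseʳ : ∀ n x → iterate h⁻ n (iterate h n x) ≡ x
  iterate-inverseʳ zero    x = refl
  iterate-inverseʳ (suc n) x = begin
    iterate h⁻ (suc n) (h (iterate h n x)) ≡⟨ iterate-suc h⁻ n _ ⟩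
    iterate h⁻ n (h⁻ (h (iterate h n x)))  ≡⟨ cong (iterate h⁻ n) (h⁻∘h≗id _) ⟩
    iterate h⁻ n (iterate h n x)           ≡⟨ iterate-inverseʳ n x ⟩
    x                                      ∎

  iterate-injective : ∀ n {x y} → iterate h n x ≡ iterate h n y → x ≡ y
  iterate-injective n {x} {y} eq = begin
    x                            ≡⟨ iterate-inverseʳ n x ⟨
    iterate h⁻ n (iterate h n x) ≡⟨ cong (iterate h⁻ n) eq ⟩
    iterate h⁻ n (iterate h n y) ≡⟨ iterate-inverseʳ n y ⟩
    y                            ∎

  iterate-transpose : ∀ m n {x y} → iterate h m x ≡ iterate h n y → iterate h⁻ n x ≡ iterate h⁻ m y
  iterate-transpose m n {x} {y} eq = begin
    iterate h⁻ n x                              ≡⟨ cong (iterate h⁻ n) x≡ ⟩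
    iterate h⁻ n (iterate h⁻ m (iterate h n y)) ≡⟨ iterate-comm h⁻ n m _ ⟩
    iterate h⁻ m (iterate h⁻ n (iterate h n y)) ≡⟨ cong (iterate h⁻ m) (iterate-inverseʳ n y) ⟩
    iterate h⁻ m y                              ∎
    where
    x≡ : x ≡ iterate h⁻ m (iterate h n y)
    x≡ = trans (sym (iterate-inverseʳ m x)) (cong (iterate h⁻ m) eq)

  iterate-collision : ∀ m t {x} → iterate h m x ≡ iterate h (m + t) x → iterate h t x ≡ x
  iterate-collision m t {x} eq = sym (iterate-injective m (trans eq (iterate-+ h m t x)))

record Least (P : ℕ → Set) : Set where
  field
    witness : ℕ
    holds   : P witness
    minimal : ∀ {j} → j < witness → ¬ P j

  witness-≤ : ∀ {n} → P n → witness ≤ n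
  witness-≤ pn = ≮⇒≥ (λ n<witness → minimal n<witness pn)

open Least

module _ {P : ℕ → Set} (P? : ∀ n → Dec (P n)) where

  minimise-from : ∀ k n → (∀ {j} → j < k → ¬ P j) → P (n + k) → Least P
  minimise-from k n       none<k p with P? k
  ... | yes pk = record { witness = k ; holds = pk ; minimal = none<k }
  minimise-from k zero    none<k p | no ¬pk = contradiction p ¬pk
  minimise-from k (suc n) none<k p | no ¬pk =
    minimise-from (suc k) n none≤k (subst P (sym (+-suc n k)) p)
    where
    none≤k : ∀ {j} → j < suc k → ¬ P j
    none≤k j<1+k with m≤n⇒m<n∨m≡n (s≤s⁻¹ j<1+k)
    ... | inj₁ j<k  = none<k j<k
    ... | inj₂ refl = ¬pk

  minimise : ∀ {n} → P n → Least P
  minimise {n} p = minimise-from 0 n (λ ()) (subst P (sym (+-identityʳ n)) p)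

-- `Period h x d` says that suc d is a period of x under h; periods are thus positive by construction.
Period : (ℕ → ℕ) → ℕ → ℕ → Set
Period h x d = iterate h (suc d) x ≡ x

module _ (h : ℕ → ℕ) (x : ℕ) where

  period? : ∀ d → Dec (Period h x d)
  period? d = iterate h (suc d) x ≟ x

  least-period-divides : (L : Least (Period h x)) → ∀ t → iterate h t x ≡ x → t % suc (witness L) ≡ 0
  least-period-divides L t hᵗx≡x with t % suc (witness L) in t%d≡r
  ... | zero  = refl
  ... | suc r = contradiction hʳx≡x (minimal L (s≤s⁻¹ r<d))
    where
    hʳx≡x : Period h x r
    hʳx≡x = subst (λ k → iterate h k x ≡ x) t%d≡r (trans (sym (iterate-% h (holds L) t)) hᵗx≡x)
    r<d : suc r < suc (witness L)
    r<d = subst (_< suc (witness L)) t%d≡r (m%n<n t (suc (witness L)))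

  period-divides⇒return : ∀ d t → Period h x d → t % suc d ≡ 0 → iterate h t x ≡ x
  period-divides⇒return d t p t%d≡0 = begin
    iterate h t x           ≡⟨ iterate-% h p t ⟩
    iterate h (t % suc d) x ≡⟨ cong (λ k → iterate h k x) t%d≡0 ⟩
    x                       ∎

_⁺ _⁻ : ℤ → ℕ
(+ n)    ⁺ = n
-[1+ n ] ⁺ = 0
(+ n)    ⁻ = 0
-[1+ n ] ⁻ = suc n

module _ (f : RecPerm) where
  open Inverse f renaming (to to F; from to F⁻¹)

  pow-suc : ∀ k x → pow f (ℤ.suc k) x ≡ F (pow f k x)
  pow-suc (+ n)        x = refl
  pow-suc -[1+ zero ]  x = sym (strictlyInverseˡ x)
  pow-suc -[1+ suc n ] x = sym (strictlyInverseˡ _)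

  pow-split : ∀ a x → pow f a x ≡ iterate F⁻¹ (a ⁻) (iterate F (a ⁺) x)
  pow-split (+ n)    x = refl
  pow-split -[1+ n ] x = refl

  pow-≡⇒iterate-≡ : ∀ a b x → pow f a x ≡ pow f b x → iterate F (b ⁻ + a ⁺) x ≡ iterate F (a ⁻ + b ⁺) x
  pow-≡⇒iterate-≡ a b x eq = begin
    iterate F (b ⁻ + a ⁺) x             ≡⟨ iterate-+ F (b ⁻) (a ⁺) x ⟩
    iterate F (b ⁻) (iterate F (a ⁺) x) ≡⟨ iterate-transpose {h = F⁻¹} strictlyInverseˡ (a ⁻) (b ⁻) split-eq ⟩
    iterate F (a ⁻) (iterate F (b ⁺) x) ≡⟨ iterate-+ F (a ⁻) (b ⁺) x ⟨
    iterate F (a ⁻ + b ⁺) x             ∎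
    where
    split-eq : iterate F⁻¹ (a ⁻) (iterate F (a ⁺) x) ≡ iterate F⁻¹ (b ⁻) (iterate F (b ⁺) x)
    split-eq = trans (sym (pow-split a x)) (trans eq (pow-split b x))

  iterate-≡⇒pow-≡ : ∀ a b x → iterate F (b ⁻ + a ⁺) x ≡ iterate F (a ⁻ + b ⁺) x → pow f a x ≡ pow f b x
  iterate-≡⇒pow-≡ a b x eq = begin
    pow f a x                             ≡⟨ pow-split a x ⟩
    iterate F⁻¹ (a ⁻) (iterate F (a ⁺) x) ≡⟨ iterate-transpose {h⁻ = F⁻¹} strictlyInverseʳ (b ⁻) (a ⁻) split-eq ⟩
    iterate F⁻¹ (b ⁻) (iterate F (b ⁺) x) ≡⟨ pow-split b x ⟨
    pow f b x                             ∎
    where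
    split-eq : iterate F (b ⁻) (iterate F (a ⁺) x) ≡ iterate F (a ⁻) (iterate F (b ⁺) x)
    split-eq = trans (sym (iterate-+ F (b ⁻) (a ⁺) x)) (trans eq (iterate-+ F (a ⁻) (b ⁺) x))

  iterate-from-periodic : ∀ {x d} → Period F x d → ∀ m → iterate F⁻¹ m x ≡ iterate F (m * d) x
  iterate-from-periodic {x} {d} p m = begin
    iterate F⁻¹ m x                                   ≡⟨ cong (iterate F⁻¹ m) (iterate-* F p m) ⟨
    iterate F⁻¹ m (iterate F (m * suc d) x)           ≡⟨ cong (λ k → iterate F⁻¹ m (iterate F k x)) (*-suc m d) ⟩
    iterate F⁻¹ m (iterate F (m + m * d) x)           ≡⟨ cong (iterate F⁻¹ m) (iterate-+ F m (m * d) x) ⟩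
    iterate F⁻¹ m (iterate F m (iterate F (m * d) x)) ≡⟨ iterate-inverseʳ strictlyInverseʳ m _ ⟩
    iterate F (m * d) x                               ∎

  cycle-of-periodic : ∀ {x d y} → Period F x d → InCycle f x y →
                      ∃ λ i → i < suc d × iterate F i x ≡ y
  cycle-of-periodic {d = d} p (+ n , refl) =
    n % suc d , m%n<n n (suc d) , sym (iterate-% F p n)
  cycle-of-periodic {d = d} p (-[1+ n ] , refl) =
    (suc n * d) % suc d , m%n<n (suc n * d) (suc d) ,
    sym (trans (iterate-from-periodic {d = d} p (suc n)) (iterate-% F p (suc n * d)))

module _ {u s : ℕ → ℕ} {k : ℕ} (covered : ∀ n → ∃ λ i → i < k × u i ≡ s n) where
  private
    index : Fin (suc k) → Fin k
    index n = fromℕ< (proj₁ (proj₂ (covered (toℕ n))))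

    index-sound : ∀ n → u (toℕ (index n)) ≡ s (toℕ n)
    index-sound n = trans (cong u (toℕ-fromℕ< _)) (proj₂ (proj₂ (covered (toℕ n))))

  sequence-pigeonhole : ∃₂ λ m n → m < n × n ≤ k × s m ≡ s n
  sequence-pigeonhole with pigeonhole (n<1+n k) index
  ... | m , n , m<n , same = toℕ m , toℕ n , m<n , s≤s⁻¹ (toℕ<n n) ,
    trans (sym (index-sound m)) (trans (cong (u ∘ toℕ) same) (index-sound n))

module _ (f g : RecPerm) {x : ℕ} (g⊆f : ∀ y → InCycle g x y → InCycle f x y) where
  open Inverse f using () renaming (to to F)
  open Inverse g using () renaming (to to G; from to G⁻¹; strictlyInverseʳ to G⁻¹∘G≗id)

  period-bound : ∀ {d} → Period F x d → ∃ λ e → e ≤ d × Period G x e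
  period-bound {d} p with sequence-pigeonhole (λ n → cycle-of-periodic f p (g⊆f _ (+ n , refl)))
  ... | m , n , m<n , n≤1+d , Gᵐx≡Gⁿx with m≤n⇒∃[o]m+o≡n m<n
  ... | e , refl = e , m+n≤o⇒n≤o m (s≤s⁻¹ n≤1+d) ,
    iterate-collision {h⁻ = G⁻¹} G⁻¹∘G≗id m (suc e) (trans Gᵐx≡Gⁿx (cong (λ k → iterate G k x) (sym (+-suc m e))))

  least-period-≤ : (Lf : Least (Period F x)) (Lg : Least (Period G x)) → witness Lg ≤ witness Lf
  least-period-≤ Lf Lg with period-bound (holds Lf)
  ... | e , e≤d , pe = ≤-trans (witness-≤ Lg pe) e≤d

SameCycle : RecPerm → RecPerm → ℕ → Set
SameCycle f g x = ∀ y → InCycle f x y ⇔ InCycle g x y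

module _ {f g : RecPerm} {x : ℕ} (same : SameCycle f g x) where
  open Inverse f using () renaming (to to F; from to F⁻¹; strictlyInverseʳ to F⁻¹∘F≗id)
  open Inverse g using () renaming (to to G)

  least-periods-agree : (Lf : Least (Period F x)) (Lg : Least (Period G x)) → witness Lf ≡ witness Lg
  least-periods-agree Lf Lg = ≤-antisym
    (least-period-≤ g f (λ y → Equivalence.to (same y)) Lg Lf)
    (least-period-≤ f g (λ y → Equivalence.from (same y)) Lf Lg)

  return-transfer : ∀ t → iterate F t x ≡ x → iterate G t x ≡ x
  return-transfer zero    _     = refl
  return-transfer (suc t) Fᵗx≡x = period-divides⇒return G x (witness Lg) (suc t) (holds Lg)
    (subst (λ d → suc t % suc d ≡ 0) (least-periods-agree Lf Lg) (least-period-divides F x Lf (suc t) Fᵗx≡x))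
    where
    Lf : Least (Period F x)
    Lf = minimise (period? F x) {t} Fᵗx≡x
    G-period : ∃ λ e → e ≤ witness Lf × Period G x e
    G-period = period-bound f g (λ y → Equivalence.from (same y)) (holds Lf)
    Lg : Least (Period G x)
    Lg = minimise (period? G x) {proj₁ G-period} (proj₂ (proj₂ G-period))

  iterate-transfer-≤ : ∀ {m n} → m ≤ n → iterate F m x ≡ iterate F n x → iterate G m x ≡ iterate G n x
  iterate-transfer-≤ {m} m≤n eq with m≤n⇒∃[o]m+o≡n m≤n
  ... | t , refl = begin
    iterate G m x               ≡⟨ cong (iterate G m) (return-transfer t (iterate-collision {h⁻ = F⁻¹} F⁻¹∘F≗id m t eq)) ⟨
    iterate G m (iterate G t x) ≡⟨ iterate-+ G m t x ⟨
    iterate G (m + t) x         ∎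

  iterate-transfer : ∀ m n → iterate F m x ≡ iterate F n x → iterate G m x ≡ iterate G n x
  iterate-transfer m n eq with ≤-total m n
  ... | inj₁ m≤n = iterate-transfer-≤ m≤n eq
  ... | inj₂ n≤m = sym (iterate-transfer-≤ n≤m (sym eq))

  pow-transfer : ∀ a b → pow f a x ≡ pow f b x → pow g a x ≡ pow g b x
  pow-transfer a b eq = iterate-≡⇒pow-≡ g a b x
    (iterate-transfer (b ⁻ + a ⁺) (a ⁻ + b ⁺) (pow-≡⇒iterate-≡ f a b x eq))

module _ {Π : Rel ℕ 0ℓ} (isDecEquivalence : IsDecEquivalence Π) where
  open IsDecEquivalence isDecEquivalence
    renaming (refl to Π-refl; sym to Π-sym; trans to Π-trans; _≟_ to _Π?_)

  least-in-block : ∀ x → Least (λ y → Π y x)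
  least-in-block x = minimise (_Π? x) {x} Π-refl

  representative : ℕ → ℕ
  representative x = witness (least-in-block x)

  representative-related : ∀ x → Π (representative x) x
  representative-related x = holds (least-in-block x)

  representative-cong : ∀ {x y} → Π x y → representative x ≡ representative y
  representative-cong {x} {y} x~y = ≤-antisym
    (witness-≤ (least-in-block x) (Π-trans (representative-related y) (Π-sym x~y)))
    (witness-≤ (least-in-block y) (Π-trans (representative-related x) x~y))

  module CycleMap (f g : RecPerm)
    (Π⇔f : ∀ x y → Π x y ⇔ InCycle f x y) (Π⇔g : ∀ x y → Π x y ⇔ InCycle g x y) where
    open Inverse f using () renaming (to to F)
    open Inverse g using () renaming (to to G)

    same-cycle : ∀ x → SameCycle f g x
    same-cycle x y = ⇔-trans (⇔-sym (Π⇔f x y)) (Π⇔g x y)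

    exponent : ∀ x → InCycle f (representative x) x
    exponent x = Equivalence.to (Π⇔f (representative x) x) (representative-related x)

    cycleMap : ℕ → ℕ
    cycleMap x = pow g (proj₁ (exponent x)) (representative x)

    cycleMap-unique : ∀ x k → pow f k (representative x) ≡ x → cycleMap x ≡ pow g k (representative x)
    cycleMap-unique x k fᵏr≡x = pow-transfer (same-cycle (representative x)) (proj₁ (exponent x)) k
      (trans (proj₂ (exponent x)) (sym fᵏr≡x))

    cycleMap-related : ∀ x → Π x (cycleMap x)
    cycleMap-related x = Π-trans (Π-sym (representative-related x))
      (Equivalence.from (Π⇔g (representative x) (cycleMap x)) (proj₁ (exponent x) , refl))

    representative-cycleMap : ∀ x → representative (cycleMap x) ≡ representative x
    representative-cycleMap x = sym (representative-cong (cycleMap-related x))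

    cycleMap-conjugates : ∀ x → cycleMap (F x) ≡ G (cycleMap x)
    cycleMap-conjugates x = begin
      cycleMap (F x)                         ≡⟨ cycleMap-unique (F x) (ℤ.suc k) fᵏ⁺¹r≡Fx ⟩
      pow g (ℤ.suc k) (representative (F x)) ≡⟨ cong (pow g (ℤ.suc k)) r-Fx≡r ⟩
      pow g (ℤ.suc k) (representative x)     ≡⟨ pow-suc g k (representative x) ⟩
      G (cycleMap x)                         ∎
      where
      k : ℤ
      k = proj₁ (exponent x)
      r-Fx≡r : representative (F x) ≡ representative x
      r-Fx≡r = sym (representative-cong (Equivalence.from (Π⇔f x (F x)) (+ 1 , refl)))
      fᵏ⁺¹r≡Fx : pow f (ℤ.suc k) (representative (F x)) ≡ F x
      fᵏ⁺¹r≡Fx = begin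
        pow f (ℤ.suc k) (representative (F x)) ≡⟨ cong (pow f (ℤ.suc k)) r-Fx≡r ⟩
        pow f (ℤ.suc k) (representative x)     ≡⟨ pow-suc f k (representative x) ⟩
        F (pow f k (representative x))         ≡⟨ cong F (proj₂ (exponent x)) ⟩
        F x                                    ∎

  cycleMap-inverse : (f g : RecPerm)
    (Π⇔f : ∀ x y → Π x y ⇔ InCycle f x y) (Π⇔g : ∀ x y → Π x y ⇔ InCycle g x y) →
    ∀ x → CycleMap.cycleMap g f Π⇔g Π⇔f (CycleMap.cycleMap f g Π⇔f Π⇔g x) ≡ x
  cycleMap-inverse f g Π⇔f Π⇔g x = begin
    GF.cycleMap y              ≡⟨ GF.cycleMap-unique y k (cong (pow g k) (FG.representative-cycleMap x)) ⟩
    pow f k (representative y) ≡⟨ cong (pow f k) (FG.representative-cycleMap x) ⟩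
    pow f k (representative x) ≡⟨ proj₂ (FG.exponent x) ⟩
    x                          ∎
    where
    module FG = CycleMap f g Π⇔f Π⇔g
    module GF = CycleMap g f Π⇔g Π⇔f
    y : ℕ
    y = FG.cycleMap x
    k : ℤ
    k = proj₁ (FG.exponent x)

proposition2p9 : (Π : Rel ℕ 0ℓ) → IsDecEquivalence Π → (f g : RecPerm)
    → (∀ x y → Π x y ⇔ InCycle f x y)
    → (∀ x y → Π x y ⇔ InCycle g x y)
    → Σ RecPerm (λ h → ∀ x → Inverse.to f x ≡ Inverse.from h (Inverse.to g (Inverse.to h x)))
proposition2p9 Π isDecEquivalence f g Π⇔f Π⇔g = h , conjugates
  where
  module FG = CycleMap isDecEquivalence f g Π⇔f Π⇔g
  module GF = CycleMap isDecEquivalence g f Π⇔g Π⇔f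

  h : RecPerm
  h = mk↔ₛ′ FG.cycleMap GF.cycleMap
    (cycleMap-inverse isDecEquivalence g f Π⇔g Π⇔f) (cycleMap-inverse isDecEquivalence f g Π⇔f Π⇔g)

  conjugates : ∀ x → Inverse.to f x ≡ GF.cycleMap (Inverse.to g (FG.cycleMap x))
  conjugates x = begin
    Inverse.to f x                             ≡⟨ cycleMap-inverse isDecEquivalence f g Π⇔f Π⇔g (Inverse.to f x) ⟨
    GF.cycleMap (FG.cycleMap (Inverse.to f x)) ≡⟨ cong GF.cycleMap (FG.cycleMap-conjugates x) ⟩
    GF.cycleMap (Inverse.to g (FG.cycleMap x)) ∎
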